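{- Let $S$ and $T$ be monads on $\mathsf{Set}$ and let $\lambda \colon TS \Rightarrow ST$ be a natural transformation. Then $$\lambda W \circ T\omega^S \circ \omega^T S = S\omega^T \circ \omega^S T \circ W\lambda,$$ where $W$ is the writer monad and $\omega^S,\omega^T$ are defined below.
   Context: Fix a monoid $(M,\cdot,e)$. The writer monad $W$ on $\mathsf{Set}$: $WX = M \times X$, $Wf(m,x) = (m,f(x))$, $\eta^W_X(x) = (e,x)$, $\mu^W_X(m,(n,x)) = (m\cdot n, x)$. For $m \in M$, $\overline{m}_X \colon X \to M\times X$ is $\overline m_X(x) = (m,x)$. For a monad $T$ on $\mathsf{Set}$, $\omega^T \colon WT \Rightarrow TW$ is defined by $\omega^T_X(m,t) = T\overline{m}_X(t)$ for $(m,t) \in WTX$. -}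

module Defs where

open import Level using (0ℓ)
open import Function using (_∘_; id)
open import Data.Product using (_×_; _,_)
open import Relation.Binary.PropositionalEquality using (_≡_)
open import Algebra.Structures using (IsMonoid)

record Functor : Set₁ where
  field
    F      : Set → Set
    fmap   : {X Y : Set} → (X → Y) → F X → F Y
    fmap-id : {X : Set} (x : F X) → fmap id x ≡ x
    fmap-∘  : {X Y Z : Set} (g : Y → Z) (f : X → Y) (x : F X) →
              fmap (g ∘ f) x ≡ fmap g (fmap f x)

record Monad : Set₁ where
  field
    functor : Functor
  open Functor functor public
  field
    η : {X : Set} → X → F X
    μ : {X : Set} → F (F X) → F X
    η-natural : {X Y : Set} (f : X → Y) (x : X) → fmap f (η x) ≡ η (f x)
    μ-natural : {X Y : Set} (f : X → Y) (x : F (F X)) →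
                fmap f (μ x) ≡ μ (fmap (fmap f) x)
    μ-assoc : {X : Set} (x : F (F (F X))) → μ (μ x) ≡ μ (fmap μ x)
    μ-unitˡ : {X : Set} (x : F X) → μ (η x) ≡ x
    μ-unitʳ : {X : Set} (x : F X) → μ (fmap η x) ≡ x

record NatTrans (T S : Monad) : Set₁ where
  private
    module T = Monad T
    module S = Monad S
  field
    α : {X : Set} → T.F (S.F X) → S.F (T.F X)
    natural : {X Y : Set} (f : X → Y) (x : T.F (S.F X)) →
              S.fmap (T.fmap f) (α x) ≡ α (T.fmap (S.fmap f) x)

record SetMonoid : Set₁ where
  field
    Carrier  : Set
    _·_      : Carrier → Carrier → Carrier
    e        : Carrier
    isMonoid : IsMonoid _≡_ _·_ e

module Writer (𝕄 : SetMonoid) where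
  open SetMonoid 𝕄 renaming (Carrier to M)

  W : Set → Set
  W X = M × X

  Wmap : {X Y : Set} → (X → Y) → W X → W Y
  Wmap f (m , x) = (m , f x)

  ηW : {X : Set} → X → W X
  ηW x = (e , x)

  μW : {X : Set} → W (W X) → W X
  μW (m , (n , x)) = (m · n , x)

  bar : {X : Set} → M → X → W X
  bar m x = (m , x)

  ω : (T : Monad) {X : Set} → W (Monad.F T X) → Monad.F T (W X)
  ω T (m , t) = Monad.fmap T (bar m) t

{-# OPTIONS --safe #-}
module Submission where

open import Defs
open import Data.Product using (_,_)
open import Relation.Binary.PropositionalEquality using (_≡_; sym; cong; module ≡-Reasoning)

-- Since ω^S ∘ m̄ = S m̄, both sides of the equation collapse to the two sides of
-- the naturality square of λ at the component m̄_X : S X → W (S X).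

module _ (𝕄 : SetMonoid) where
  open Writer 𝕄

  fmap-ω-∘-fmap-bar : (T U : Monad) {X : Set} (m : SetMonoid.Carrier 𝕄)
                      (t : Monad.F T (Monad.F U X)) →
    Monad.fmap T (ω U) (Monad.fmap T (bar m) t) ≡ Monad.fmap T (Monad.fmap U (bar m)) t
  fmap-ω-∘-fmap-bar T U m t = sym (Monad.fmap-∘ T (ω U) (bar m) t)

proposition4p14 : (𝕄 : SetMonoid) (S T : Monad) (λ' : NatTrans T S) →
    let open Writer 𝕄 in
    {X : Set} (p : W (Monad.F T (Monad.F S X))) →
      NatTrans.α λ' (Monad.fmap T (ω S) (ω T p))
        ≡ Monad.fmap S (ω T) (ω S (Wmap (NatTrans.α λ') p))
proposition4p14 𝕄 S T λ' (m , t) = begin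
  α (T.fmap (ω S) (T.fmap (bar m) t))  ≡⟨ cong α (fmap-ω-∘-fmap-bar 𝕄 T S m t) ⟩
  α (T.fmap (S.fmap (bar m)) t)        ≡⟨ sym (NatTrans.natural λ' (bar m) t) ⟩
  S.fmap (T.fmap (bar m)) (α t)        ≡⟨ sym (fmap-ω-∘-fmap-bar 𝕄 S T m (α t)) ⟩
  S.fmap (ω T) (S.fmap (bar m) (α t))  ∎
  where
  open Writer 𝕄
  open ≡-Reasoning
  open NatTrans λ' using (α)
  module S = Monad S
  module T = Monad T
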